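{- Let $\hat g,\hat f_1,\hat f_2\in\mathbb{R}[[t]]$ with $\hat g(0)\ne0$ and $\hat f_1,\hat f_2$ of order $1$. The compressed double almost-Riordan array $(1|\hat g;\hat f_1,\hat f_2)$ is totally positive if and only if the compressed double Riordan array $(\hat g;\hat f_1,\hat f_2)$ is totally positive.
   Context: The compressed double almost-Riordan array $(\hat b|\hat g;\hat f_1,\hat f_2)$ is the infinite lower triangular matrix whose $k$-th column has generating function $\hat b$ for $k=0$, $t\hat g(\hat f_1\hat f_2)^{\ell}$ for $k=2\ell+1$, and $t\hat g\hat f_1(\hat f_1\hat f_2)^{\ell}$ for $k=2\ell+2$ (here $\hat b=1$). The compressed double Riordan array $(\hat g;\hat f_1,\hat f_2)$ is the infinite lower triangular matrix whose $k$-th column has generating function $\hat g(\hat f_1\hat f_2)^{\ell}$ for $k=2\ell$ and $\hat g\hat f_1(\hat f_1\hat f_2)^{\ell}$ for $k=2\ell+1$. A matrix is totally positive if all its minors are nonnegative. -}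

module Defs where

open import Level using (Level; _⊔_)
open import Data.Nat as ℕ using (ℕ; zero; suc; _∸_; ⌊_/2⌋)
open import Data.Bool using (Bool; true; false; if_then_else_)
open import Data.Fin as Fin using (Fin; punchIn)
open import Data.Product using (Σ; _×_)
open import Relation.Nullary using (¬_)
open import Relation.Binary.Structures using (IsTotalOrder)
open import Algebra.Bundles using (CommutativeRing)

-- An ordered field (the abstract setting standing in for ℝ):
-- a commutative ring with a total order compatible with + and *,
-- with 0 ≠ 1 and multiplicative inverses of nonzero elements.
record OrderedField (c ℓ₁ ℓ₂ : Level) : Set (Level.suc (c ⊔ ℓ₁ ⊔ ℓ₂)) where
  field
    commRing : CommutativeRing c ℓ₁
  open CommutativeRing commRing public
  field
    _≤_         : Carrier → Carrier → Set ℓ₂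
    isTotalOrder : IsTotalOrder _≈_ _≤_
    +-mono-≤    : ∀ {x y} z → x ≤ y → (x + z) ≤ (y + z)
    *-nonneg    : ∀ {x y} → 0# ≤ x → 0# ≤ y → 0# ≤ (x * y)
    0≉1         : ¬ (0# ≈ 1#)
    inverse     : ∀ x → ¬ (x ≈ 0#) → Σ Carrier (λ y → (x * y) ≈ 1#)

module Series {c ℓ₁ ℓ₂} (R : OrderedField c ℓ₁ ℓ₂) where
  open OrderedField R

  PowerSeries : Set c
  PowerSeries = ℕ → Carrier

  sumTo : ℕ → (ℕ → Carrier) → Carrier
  sumTo zero    f = 0#
  sumTo (suc n) f = sumTo n f + f n

  one : PowerSeries
  one zero    = 1#
  one (suc n) = 0#

  _⊛_ : PowerSeries → PowerSeries → PowerSeries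
  (f ⊛ g) n = sumTo (suc n) (λ i → f i * g (n ∸ i))

  pow : PowerSeries → ℕ → PowerSeries
  pow f zero    = one
  pow f (suc l) = f ⊛ pow f l

  tx : PowerSeries → PowerSeries
  tx h zero    = 0#
  tx h (suc n) = h n

  HasOrder1 : PowerSeries → Set ℓ₁
  HasOrder1 f = (f 0 ≈ 0#) × ¬ (f 1 ≈ 0#)

  isEven : ℕ → Bool
  isEven zero          = true
  isEven (suc zero)    = false
  isEven (suc (suc n)) = isEven n

  -- infinite matrices, entry (row n, column k)
  Matrix : Set c
  Matrix = ℕ → ℕ → Carrier

  -- compressed double Riordan array (g ; f1, f2):
  -- column 2l has gf g (f1 f2)^l, column 2l+1 has gf g f1 (f1 f2)^l
  doubleRiordan : PowerSeries → PowerSeries → PowerSeries → Matrix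
  doubleRiordan g f1 f2 n k =
    (if isEven k
       then g ⊛ pow (f1 ⊛ f2) ⌊ k /2⌋
       else (g ⊛ f1) ⊛ pow (f1 ⊛ f2) ⌊ k /2⌋) n

  -- compressed double almost-Riordan array (b | g ; f1, f2):
  -- column 0 has gf b, column 2l+1 has gf t g (f1 f2)^l,
  -- column 2l+2 has gf t g f1 (f1 f2)^l
  almostRiordanCol : PowerSeries → PowerSeries → PowerSeries → PowerSeries → ℕ → PowerSeries
  almostRiordanCol b g f1 f2 zero    = b
  almostRiordanCol b g f1 f2 (suc k) =
    if isEven k
      then tx (g ⊛ pow (f1 ⊛ f2) ⌊ k /2⌋)
      else tx ((g ⊛ f1) ⊛ pow (f1 ⊛ f2) ⌊ k /2⌋)

  doubleAlmostRiordan : PowerSeries → PowerSeries → PowerSeries → PowerSeries → Matrix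
  doubleAlmostRiordan b g f1 f2 n k = almostRiordanCol b g f1 f2 k n

  sumFin : ∀ m → (Fin m → Carrier) → Carrier
  sumFin zero    f = 0#
  sumFin (suc m) f = f Fin.zero + sumFin m (λ j → f (Fin.suc j))

  sign : ℕ → Carrier
  sign zero    = 1#
  sign (suc n) = - sign n

  det : ∀ m → (Fin m → Fin m → Carrier) → Carrier
  det zero    M = 1#
  det (suc m) M =
    sumFin (suc m) (λ j → sign (Fin.toℕ j) * (M Fin.zero j *
      det m (λ r s → M (Fin.suc r) (punchIn j s))))

  StrictlyIncreasing : ∀ {m} → (Fin m → ℕ) → Set
  StrictlyIncreasing {m} r = ∀ (i j : Fin m) → i Fin.< j → r i ℕ.< r j

  TotallyPositive : Matrix → Set ℓ₂
  TotallyPositive A =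
    ∀ (m : ℕ) (r s : Fin m → ℕ) → StrictlyIncreasing r → StrictlyIncreasing s →
      0# ≤ det m (λ i j → A (r i) (s j))

-- The almost-Riordan array (1 | g; f1, f2) is the direct sum 1 ⊕ (g; f1, f2): column k+1 of the
-- former is t times column k of the latter, and column 0 is e₀.  So it suffices that bordering any
-- matrix by 1 ⊕ − preserves and reflects total positivity.  A minor of 1 ⊕ D either avoids row and
-- column 0 (a minor of D), uses exactly one of them (a zero row or column), or uses both (Laplace
-- expansion along row 0 reduces it to a minor of D).  No hypothesis on g, f1, f2 is needed.
module Submission where

open import Defs
open import Relation.Nullary using (¬_)
open import Function.Bundles using (_⇔_; mk⇔)
open import Function.Construct.Composition using (_⇔-∘_)
open import Data.Nat as ℕ using (ℕ; zero; suc; z≤n; s≤s; pred)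
open import Data.Nat.Properties as ℕ using ()
open import Data.Fin as Fin using (Fin; punchIn)
open import Data.Bool using (true; false)
open import Data.Sum using (_⊎_; inj₁; inj₂)
open import Relation.Binary.PropositionalEquality as P using (_≡_)
open import Relation.Binary.Structures using (IsTotalOrder)

module _ {c ℓ₁ ℓ₂} (R : OrderedField c ℓ₁ ℓ₂) where
  open OrderedField R hiding (zero)
  open Series R
  open IsTotalOrder isTotalOrder using () renaming (reflexive to ≤-reflexive; trans to ≤-trans)

  sumFin-cong : ∀ m {f f′ : Fin m → Carrier} → (∀ j → f j ≈ f′ j) → sumFin m f ≈ sumFin m f′
  sumFin-cong zero    f≈f′ = refl
  sumFin-cong (suc m) f≈f′ = +-cong (f≈f′ Fin.zero) (sumFin-cong m (λ j → f≈f′ (Fin.suc j)))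

  sumFin-zero : ∀ m {f : Fin m → Carrier} → (∀ j → f j ≈ 0#) → sumFin m f ≈ 0#
  sumFin-zero zero    f≈0 = refl
  sumFin-zero (suc m) f≈0 =
    trans (+-cong (f≈0 Fin.zero) (sumFin-zero m (λ j → f≈0 (Fin.suc j)))) (+-identityʳ 0#)

  laplaceTerm : ∀ m → (Fin (suc m) → Fin (suc m) → Carrier) → Fin (suc m) → Carrier
  laplaceTerm m M j = sign (Fin.toℕ j) * (M Fin.zero j * det m (λ r s → M (Fin.suc r) (punchIn j s)))

  laplaceTerm-zero : ∀ m (M : Fin (suc m) → Fin (suc m) → Carrier) j →
    M Fin.zero j ≈ 0# ⊎ det m (λ r s → M (Fin.suc r) (punchIn j s)) ≈ 0# → laplaceTerm m M j ≈ 0#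
  laplaceTerm-zero m M j (inj₁ entry≈0) = trans (*-congˡ (trans (*-congʳ entry≈0) (zeroˡ _))) (zeroʳ _)
  laplaceTerm-zero m M j (inj₂ minor≈0) = trans (*-congˡ (trans (*-congˡ minor≈0) (zeroʳ _))) (zeroʳ _)

  det-cong : ∀ m {M N : Fin m → Fin m → Carrier} → (∀ i j → M i j ≈ N i j) → det m M ≈ det m N
  det-cong zero    M≈N = refl
  det-cong (suc m) {M} {N} M≈N = sumFin-cong (suc m) {laplaceTerm m M} {laplaceTerm m N} (λ j →
    *-congˡ (*-cong (M≈N Fin.zero j) (det-cong m (λ r s → M≈N (Fin.suc r) (punchIn j s)))))

  det-zeroRow : ∀ m (M : Fin (suc m) → Fin (suc m) → Carrier) →
    (∀ j → M Fin.zero j ≈ 0#) → det (suc m) M ≈ 0#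
  det-zeroRow m M row≈0 =
    sumFin-zero (suc m) {laplaceTerm m M} (λ j → laplaceTerm-zero m M j (inj₁ (row≈0 j)))

  det-zeroCol : ∀ m (M : Fin (suc m) → Fin (suc m) → Carrier) →
    (∀ i → M i Fin.zero ≈ 0#) → det (suc m) M ≈ 0#
  det-zeroCol zero    M col≈0 = det-zeroRow zero M (λ { Fin.zero → col≈0 Fin.zero })
  det-zeroCol (suc m) M col≈0 = sumFin-zero (suc (suc m)) term≈0
    where
    term≈0 : ∀ j → laplaceTerm (suc m) M j ≈ 0#
    term≈0 Fin.zero    = laplaceTerm-zero (suc m) M Fin.zero (inj₁ (col≈0 Fin.zero))
    term≈0 (Fin.suc j) = laplaceTerm-zero (suc m) M (Fin.suc j) (inj₂
      (det-zeroCol m (λ r s → M (Fin.suc r) (punchIn (Fin.suc j) s)) (λ i → col≈0 (Fin.suc i))))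

  det-unitRow : ∀ m (M : Fin (suc m) → Fin (suc m) → Carrier) →
    M Fin.zero Fin.zero ≈ 1# → (∀ j → M Fin.zero (Fin.suc j) ≈ 0#) →
    det (suc m) M ≈ det m (λ r s → M (Fin.suc r) (Fin.suc s))
  det-unitRow m M corner≈1 rest≈0 =
    trans (+-cong (trans (*-identityˡ _) (trans (*-congʳ corner≈1) (*-identityˡ _)))
                  (sumFin-zero m {λ j → laplaceTerm m M (Fin.suc j)}
                                 (λ j → laplaceTerm-zero m M (Fin.suc j) (inj₁ (rest≈0 j)))))
          (+-identityʳ _)

  TotallyPositive-cong : ∀ {A B : Matrix} → (∀ n k → A n k ≈ B n k) →
    TotallyPositive A ⇔ TotallyPositive B
  TotallyPositive-cong A≈B = mk⇔ (resp A≈B) (resp (λ n k → sym (A≈B n k)))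
    where
    resp : ∀ {A B : Matrix} → (∀ n k → A n k ≈ B n k) → TotallyPositive A → TotallyPositive B
    resp A≈B tpA m r s r↑ s↑ =
      ≤-trans (tpA m r s r↑ s↑) (≤-reflexive (det-cong m (λ i j → A≈B (r i) (s j))))

  StrictlyIncreasing-tail : ∀ {m} {r : Fin (suc m) → ℕ} → StrictlyIncreasing r →
    StrictlyIncreasing (λ i → r (Fin.suc i))
  StrictlyIncreasing-tail r↑ i j i<j = r↑ (Fin.suc i) (Fin.suc j) (s≤s i<j)

  StrictlyIncreasing-suc : ∀ {m} {r : Fin m → ℕ} → StrictlyIncreasing r →
    StrictlyIncreasing (λ i → suc (r i))
  StrictlyIncreasing-suc r↑ i j i<j = s≤s (r↑ i j i<j)

  StrictlyIncreasing-pred : ∀ {m} {r : Fin m → ℕ} → (∀ i → 1 ℕ.≤ r i) → StrictlyIncreasing r →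
    StrictlyIncreasing (λ i → pred (r i))
  StrictlyIncreasing-pred {r = r} r≥1 r↑ i j i<j with r i | r j | r≥1 i | r↑ i j i<j
  ... | suc _ | suc _ | _ | s≤s ri<rj = ri<rj

  StrictlyIncreasing-head≡0⊎positive : ∀ {m} {r : Fin (suc m) → ℕ} → StrictlyIncreasing r →
    r Fin.zero ≡ 0 ⊎ (∀ i → 1 ℕ.≤ r i)
  StrictlyIncreasing-head≡0⊎positive {r = r} r↑ with r Fin.zero in r₀≡
  ... | zero  = inj₁ P.refl
  ... | suc _ = inj₂ positive
    where
    positive : ∀ i → 1 ℕ.≤ r i
    positive Fin.zero    rewrite r₀≡ = s≤s z≤n
    positive (Fin.suc i) = ℕ.≤-trans (s≤s z≤n) (r↑ Fin.zero (Fin.suc i) (s≤s z≤n))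

  StrictlyIncreasing-tail-positive : ∀ {m} {r : Fin (suc m) → ℕ} → StrictlyIncreasing r →
    r Fin.zero ≡ 0 → ∀ i → 1 ℕ.≤ r (Fin.suc i)
  StrictlyIncreasing-tail-positive {r = r} r↑ r₀≡0 i =
    P.subst (λ r₀ → suc r₀ ℕ.≤ r (Fin.suc i)) r₀≡0 (r↑ Fin.zero (Fin.suc i) (s≤s z≤n))

  1⊕_ : Matrix → Matrix
  (1⊕ D) zero    zero    = 1#
  (1⊕ D) zero    (suc k) = 0#
  (1⊕ D) (suc n) zero    = 0#
  (1⊕ D) (suc n) (suc k) = D n k

  1⊕-pred : ∀ D {a b} → 1 ℕ.≤ a → 1 ℕ.≤ b → (1⊕ D) a b ≡ D (pred a) (pred b)
  1⊕-pred D {suc a} {suc b} _ _ = P.refl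

  1⊕-corner : ∀ D {a b} → a ≡ 0 → b ≡ 0 → (1⊕ D) a b ≈ 1#
  1⊕-corner D P.refl P.refl = refl

  1⊕-row₀ : ∀ D {a b} → a ≡ 0 → 1 ℕ.≤ b → (1⊕ D) a b ≈ 0#
  1⊕-row₀ D {b = suc b} P.refl _ = refl

  1⊕-col₀ : ∀ D {a b} → 1 ℕ.≤ a → b ≡ 0 → (1⊕ D) a b ≈ 0#
  1⊕-col₀ D {a = suc a} _ P.refl = refl

  module _ (D : Matrix) where

    minor-1⊕-positive : ∀ m {r s : Fin m → ℕ} → (∀ i → 1 ℕ.≤ r i) → (∀ j → 1 ℕ.≤ s j) →
      det m (λ i j → (1⊕ D) (r i) (s j)) ≈ det m (λ i j → D (pred (r i)) (pred (s j)))
    minor-1⊕-positive m r≥1 s≥1 = det-cong m (λ i j → reflexive (1⊕-pred D (r≥1 i) (s≥1 j)))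

    TotallyPositive-1⊕⇒ : TotallyPositive (1⊕ D) → TotallyPositive D
    TotallyPositive-1⊕⇒ tp m r s r↑ s↑ =
      tp m (λ i → suc (r i)) (λ j → suc (s j)) (StrictlyIncreasing-suc r↑) (StrictlyIncreasing-suc s↑)

    TotallyPositive-1⊕⇐ : TotallyPositive D → TotallyPositive (1⊕ D)
    TotallyPositive-1⊕⇐ tp zero r s r↑ s↑ = tp zero r s r↑ s↑
    TotallyPositive-1⊕⇐ tp (suc m) r s r↑ s↑
      with StrictlyIncreasing-head≡0⊎positive r↑ | StrictlyIncreasing-head≡0⊎positive s↑
    ... | inj₂ r≥1 | inj₂ s≥1 =
      ≤-trans (tp (suc m) _ _ (StrictlyIncreasing-pred r≥1 r↑) (StrictlyIncreasing-pred s≥1 s↑))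
              (≤-reflexive (sym (minor-1⊕-positive (suc m) r≥1 s≥1)))
    ... | inj₁ r₀≡0 | inj₂ s≥1 =
      ≤-reflexive (sym (det-zeroRow m (λ i j → (1⊕ D) (r i) (s j)) (λ j → 1⊕-row₀ D r₀≡0 (s≥1 j))))
    ... | inj₂ r≥1 | inj₁ s₀≡0 =
      ≤-reflexive (sym (det-zeroCol m (λ i j → (1⊕ D) (r i) (s j)) (λ i → 1⊕-col₀ D (r≥1 i) s₀≡0)))
    ... | inj₁ r₀≡0 | inj₁ s₀≡0 =
      ≤-trans (tp m (λ i → pred (r (Fin.suc i))) (λ j → pred (s (Fin.suc j)))
                  (StrictlyIncreasing-pred r′≥1 (StrictlyIncreasing-tail r↑))
                  (StrictlyIncreasing-pred s′≥1 (StrictlyIncreasing-tail s↑)))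
              (≤-reflexive (sym (trans (det-unitRow m (λ i j → (1⊕ D) (r i) (s j))
                                                    (1⊕-corner D r₀≡0 s₀≡0)
                                                    (λ j → 1⊕-row₀ D r₀≡0 (s′≥1 j)))
                                       (minor-1⊕-positive m r′≥1 s′≥1))))
      where
      r′≥1 = StrictlyIncreasing-tail-positive r↑ r₀≡0
      s′≥1 = StrictlyIncreasing-tail-positive s↑ s₀≡0

    TotallyPositive-1⊕⇔ : TotallyPositive (1⊕ D) ⇔ TotallyPositive D
    TotallyPositive-1⊕⇔ = mk⇔ TotallyPositive-1⊕⇒ TotallyPositive-1⊕⇐

  doubleAlmostRiordan-one≈1⊕doubleRiordan : ∀ g f1 f2 n k →
    doubleAlmostRiordan one g f1 f2 n k ≈ (1⊕ doubleRiordan g f1 f2) n k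
  doubleAlmostRiordan-one≈1⊕doubleRiordan g f1 f2 zero    zero    = refl
  doubleAlmostRiordan-one≈1⊕doubleRiordan g f1 f2 (suc n) zero    = refl
  doubleAlmostRiordan-one≈1⊕doubleRiordan g f1 f2 zero    (suc k) with isEven k
  ... | true  = refl
  ... | false = refl
  doubleAlmostRiordan-one≈1⊕doubleRiordan g f1 f2 (suc n) (suc k) with isEven k
  ... | true  = refl
  ... | false = refl

proposition5p3 : ∀ {c ℓ₁ ℓ₂} (R : OrderedField c ℓ₁ ℓ₂) →
    let open OrderedField R
        open Series R
    in (g f1 f2 : PowerSeries) → ¬ (g 0 ≈ 0#) → HasOrder1 f1 → HasOrder1 f2 →
       TotallyPositive (doubleAlmostRiordan one g f1 f2) ⇔ TotallyPositive (doubleRiordan g f1 f2)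
proposition5p3 R g f1 f2 _ _ _ =
  TotallyPositive-1⊕⇔ R (doubleRiordan g f1 f2)
    ⇔-∘ TotallyPositive-cong R (doubleAlmostRiordan-one≈1⊕doubleRiordan R g f1 f2)
  where open Series R
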